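{- Let $G$ be a connected bipartite simple graph on $[d]$ and suppose the edge polytope $\mathcal{P}_G$ has a separating hyperplane $\mathcal{H}$ of type II. Then there exists a separating hyperplane $\mathcal{H}'$ of type I of $\mathcal{P}_G$ which gives the same decomposition, i.e. $\{\mathcal{P}_G\cap\mathcal{H}'^{(+)},\mathcal{P}_G\cap\mathcal{H}'^{(-)}\}=\{\mathcal{P}_G\cap\mathcal{H}^{(+)},\mathcal{P}_G\cap\mathcal{H}^{(-)}\}$.
   Context: For an edge $e=(i,j)$, $\rho(e)=\mathbf{e}_i+\mathbf{e}_j\in\mathbb{R}^d$; the edge polytope $\mathcal{P}_G$ is the convex hull of $\{\rho(e):e\in E(G)\}$. A separating hyperplane of a polytope $P$ is a hyperplane $\mathcal{H}$ meeting the relative interior of $P$ (and not containing $P$) such that both $P\cap\mathcal{H}^{(+)}$ and $P\cap\mathcal{H}^{(-)}$ are integral polytopes, where for $\mathcal{H}:\sum a_ix_i=0$ we set $\mathcal{H}^{(+)}=\{\sum a_ix_i\ge0\}$, $\mathcal{H}^{(-)}=\{\sum a_ix_i\le0\}$. A hyperplane $\sum_i a_ix_i=0$ is of type I if every $a_i\in\{1,-1\}$, and of type II if every $a_i\in\{ -1,0,1\}$ and at least one $a_i=0$.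
   Formalization: Points are taken in ℚ^d rather than ℝ^d, so the edge polytope $\mathcal{P}_G$, its intersections with the half-spaces, their relative interiors and their vertices consist of rational points. -}

module Defs where

open import Data.Bool using (Bool; true; false)
open import Data.Nat using (ℕ; zero; suc)
open import Data.Fin using (Fin; zero; suc)
open import Data.Integer using (ℤ; +_)
open import Data.Rational using (ℚ; 0ℚ; 1ℚ; ½; _+_; _*_; _-_; -_; _≤_; _<_; _/_)
open import Data.Product using (Σ; ∃; ∃-syntax; _×_; _,_)
open import Data.Sum using (_⊎_)
open import Data.List using (List; []; _∷_)
open import Relation.Binary.PropositionalEquality using (_≡_; _≢_)
open import Relation.Nullary using (¬_)

Point : ℕ → Set
Point d = Fin d → ℚ

Σℚ : ∀ {n} → (Fin n → ℚ) → ℚ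
Σℚ {zero}  f = 0ℚ
Σℚ {suc n} f = f zero + Σℚ (λ i → f (suc i))

unit : ∀ {d} → Fin d → Point d
unit i j with i Data.Fin.≟ j
... | Relation.Nullary.yes _ = 1ℚ
... | Relation.Nullary.no  _ = 0ℚ

ρ : ∀ {d} → Fin d → Fin d → Point d
ρ i j k = unit i k + unit j k

record SimpleGraph (d : ℕ) : Set where
  field
    Adj   : Fin d → Fin d → Bool
    sym   : ∀ i j → Adj i j ≡ Adj j i
    irrefl : ∀ i → Adj i i ≡ false
open SimpleGraph public

data Walk {d} (G : SimpleGraph d) : Fin d → Fin d → Set where
  here : ∀ {i} → Walk G i i
  step : ∀ {i j k} → Adj G i j ≡ true → Walk G j k → Walk G i k

Connected : ∀ {d} → SimpleGraph d → Set
Connected G = ∀ i j → Walk G i j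

Bipartite : ∀ {d} → SimpleGraph d → Set
Bipartite {d} G = Σ (Fin d → Bool) λ c → ∀ i j → Adj G i j ≡ true → c i ≢ c j

-- Edge polytope P_G = conv{ ρ(e) : e ∈ E(G) }, as a set of rational points:
-- x ∈ P_G iff x is a convex combination of the ρ(i,j) with {i,j} an edge
-- (weights indexed by ordered pairs, zero off the edge set).
EdgePolytope : ∀ {d} → SimpleGraph d → Point d → Set
EdgePolytope {d} G x =
  Σ (Fin d → Fin d → ℚ) λ λw →
    (∀ i j → 0ℚ ≤ λw i j)
  × (∀ i j → λw i j ≢ 0ℚ → Adj G i j ≡ true)
  × (Σℚ (λ i → Σℚ (λ j → λw i j)) ≡ 1ℚ)
  × (∀ k → x k ≡ Σℚ (λ i → Σℚ (λ j → λw i j * ρ i j k)))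

Subset : ℕ → Set₁
Subset d = Point d → Set

lin : ∀ {d} → Point d → Point d → ℚ
lin a x = Σℚ (λ i → a i * x i)

_∩H⁺_ : ∀ {d} → Subset d → Point d → Subset d
(P ∩H⁺ a) x = P x × (0ℚ ≤ lin a x)

_∩H⁻_ : ∀ {d} → Subset d → Point d → Subset d
(P ∩H⁻ a) x = P x × (lin a x ≤ 0ℚ)

-- relative interior of a convex set P (Rockafellar, Thm 6.4):
-- x ∈ P and for every y ∈ P, x can be pushed beyond itself away from y.
RelInt : ∀ {d} → Subset d → Subset d
RelInt P x = P x × (∀ y → P y → Σ ℚ λ ε → (0ℚ < ε) × P (λ k → x k + ε * (x k - y k)))

Vertex : ∀ {d} → Subset d → Subset d
Vertex P x = P x × (∀ y z → P y → P z → (∀ k → x k ≡ ½ * (y k + z k)) → ∀ k → y k ≡ z k)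

IsIntegerℚ : ℚ → Set
IsIntegerℚ q = Σ ℤ λ z → q ≡ z / 1

-- integral polytope: all vertices have integer coordinates
-- (applied only to sets that are polytopes, namely P ∩ half-space)
Integral : ∀ {d} → Subset d → Set
Integral P = ∀ x → Vertex P x → ∀ k → IsIntegerℚ (x k)

Separating : ∀ {d} → Subset d → Point d → Set
Separating P a =
    (Σ _ λ x → RelInt P x × lin a x ≡ 0ℚ)
  × ¬ (∀ x → P x → lin a x ≡ 0ℚ)
  × Integral (P ∩H⁺ a)
  × Integral (P ∩H⁻ a)

TypeI : ∀ {d} → Point d → Set
TypeI a = ∀ i → (a i ≡ 1ℚ) ⊎ (a i ≡ - 1ℚ)

TypeII : ∀ {d} → Point d → Set
TypeII a = (∀ i → (a i ≡ 1ℚ) ⊎ ((a i ≡ - 1ℚ) ⊎ (a i ≡ 0ℚ))) × (Σ _ λ i → a i ≡ 0ℚ)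

_≐_ : ∀ {d} → Subset d → Subset d → Set
P ≐ Q = ∀ x → (P x → Q x) × (Q x → P x)

SameDecomposition : ∀ {d} → Subset d → Point d → Point d → Set
SameDecomposition P a a' =
    ((P ∩H⁺ a') ≐ (P ∩H⁺ a) × (P ∩H⁻ a') ≐ (P ∩H⁻ a))
  ⊎ ((P ∩H⁺ a') ≐ (P ∩H⁻ a) × (P ∩H⁻ a') ≐ (P ∩H⁺ a))

-- Colour G properly and let b be a with its sign flipped on one colour class, so that on an
-- edge the value a p + a q is ± (b p - b q). Suppose a is positive on the edge ij and negative
-- on kl. If ρ(ij) and ρ(kl) span an edge of P_G, that edge meets H in a vertex of P_G ∩ H⁺
-- having a coordinate strictly between 0 and 1, which integrality forbids. Such polytope edges
-- are exposed by an explicit vertex potential whenever ij and kl share a vertex, or i and k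
-- lie in the same colour class and i and l are not adjacent. It follows that all positive
-- edges carry the same pair of b-values α > β at their ends, the negative edges carry them
-- reversed, and zero edges carry equal values; by connectedness b takes only the values α and
-- β. Writing b = ν + μ s with s = ± 1, a = σ (ν + μ s) for the colour sign σ, and since
-- σ p + σ q = 0 on every edge, a agrees on P_G with μ times the type I form σ s.

module Submission where

open import Defs hiding (sym)
open import Algebra.Bundles using (CommutativeRing)
open import Data.Bool as Bool using (Bool; true; false; not; if_then_else_)
open import Data.Bool.Properties using (¬-not)
open import Data.Empty using (⊥; ⊥-elim)
open import Data.Fin using (Fin; zero; suc)
import Data.Fin.Properties as Fin
import Data.Integer as ℤ
open import Data.Integer.GCD using (gcd-zeroʳ)
import Data.Integer.Properties as ℤ
open import Data.List using (List; []; _∷_; foldr)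
open import Data.List.Membership.Propositional using (_∈_; _∉_)
open import Data.List.Relation.Unary.All using (All; []; _∷_)
open import Data.List.Relation.Unary.Any using (here; there)
open import Data.List.Relation.Unary.Unique.Propositional using (Unique; []; _∷_)
open import Data.Nat as ℕ using (ℕ)
open import Data.Product using (Σ; _×_; _,_; proj₁; proj₂; uncurry; swap)
open import Data.Product.Properties using (≡-dec; ,-injectiveˡ; ,-injectiveʳ)
open import Data.Rational
  using (ℚ; 0ℚ; 1ℚ; ½; _+_; _*_; _-_; -_; 1/_; _≤_; _<_; _/_; ↥_; ↧_; _≟_; _≤?_; _<?_; *≤*;
         NonZero; nonNegative; positive; negative)
open import Data.Rational.Properties
open import Data.Sum as Sum using (_⊎_; inj₁; inj₂; [_,_])
open import Function using (_∘_)
open import Level using (0ℓ)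
open import Relation.Binary.Definitions using (DecidableEquality; tri<; tri≈; tri>)
open import Relation.Binary.PropositionalEquality
  using (_≡_; _≢_; refl; sym; trans; cong; cong₂; subst; module ≡-Reasoning)
open import Relation.Nullary using (¬_; yes; no; Dec)
open import Relation.Nullary.Decidable using (dec⇒maybe; True; toWitness; _⊎-dec_; _×-dec_)
open import Tactic.RingSolver using (solve-∀)
import Tactic.RingSolver.Core.AlmostCommutativeRing as ACR

open import Algebra.Properties.Group +-0-group using (inverseˡ-unique; inverseʳ-unique; ⁻¹-involutive)
open import Algebra.Properties.Ring +-*-ring using (-1*x≈-x)
open import Algebra.Properties.Semiring.Sum (CommutativeRing.semiring +-*-commutativeRing)
  using (sum; ∑-distrib-+; ∑-comm; *-distribˡ-sum)

ℚ-ring : ACR.AlmostCommutativeRing 0ℓ 0ℓ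
ℚ-ring = ACR.fromCommutativeRing +-*-commutativeRing (λ q → dec⇒maybe (0ℚ ≟ q))

nonpos-+-zero : ∀ {x y : ℚ} → x ≤ 0ℚ → y ≤ 0ℚ → x + y ≡ 0ℚ → x ≡ 0ℚ
nonpos-+-zero {x} {y} x≤0 y≤0 x+y≡0 = ≤-antisym x≤0 (begin
  0ℚ     ≡⟨ x+y≡0 ⟨
  x + y  ≤⟨ +-monoʳ-≤ x y≤0 ⟩
  x + 0ℚ ≡⟨ +-identityʳ x ⟩
  x      ∎)
  where open ≤-Reasoning

nonneg-+-zero : ∀ {x y : ℚ} → 0ℚ ≤ x → 0ℚ ≤ y → x + y ≡ 0ℚ → x ≡ 0ℚ
nonneg-+-zero {x} {y} 0≤x 0≤y x+y≡0 = ≤-antisym (begin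
  x      ≡⟨ +-identityʳ x ⟨
  x + 0ℚ ≤⟨ +-monoʳ-≤ x 0≤y ⟩
  x + y  ≡⟨ x+y≡0 ⟩
  0ℚ     ∎) 0≤x
  where open ≤-Reasoning

nonneg*neg≡0 : ∀ {x y : ℚ} → 0ℚ ≤ x → y < 0ℚ → x * y ≡ 0ℚ → x ≡ 0ℚ
nonneg*neg≡0 {x} {y} 0≤x y<0 xy≡0 =
  ≤-antisym (*-cancelʳ-≤-neg y {{negative y<0}} (≤-reflexive (trans (*-zeroˡ y) (sym xy≡0)))) 0≤x

+≡0⇒≡-ˡ : ∀ {x y : ℚ} → x + y ≡ 0ℚ → x ≡ - y
+≡0⇒≡-ˡ {x} {y} = inverseˡ-unique x y

+≡0⇒≡-ʳ : ∀ {x y : ℚ} → x + y ≡ 0ℚ → y ≡ - x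
+≡0⇒≡-ʳ {x} {y} = inverseʳ-unique x y

+≡0-cancelʳ : ∀ {x y z : ℚ} → x + z ≡ 0ℚ → y + z ≡ 0ℚ → x ≡ y
+≡0-cancelʳ x+z≡0 y+z≡0 = trans (+≡0⇒≡-ˡ x+z≡0) (sym (+≡0⇒≡-ˡ y+z≡0))

≤-by-computation : {p q : ℚ} → {True (p ≤? q)} → p ≤ q
≤-by-computation {p} {q} {p≤q} = toWitness p≤q

<-by-computation : {p q : ℚ} → {True (p <? q)} → p < q
<-by-computation {p} {q} {p<q} = toWitness p<q

-- Finite sums

Σℚ≡sum : ∀ {n} (f : Fin n → ℚ) → Σℚ f ≡ sum f
Σℚ≡sum {ℕ.zero}  f = refl
Σℚ≡sum {ℕ.suc n} f = cong (f zero +_) (Σℚ≡sum (λ i → f (suc i)))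

Σℚ-cong : ∀ {n} {f g : Fin n → ℚ} → (∀ i → f i ≡ g i) → Σℚ f ≡ Σℚ g
Σℚ-cong {ℕ.zero}  _   = refl
Σℚ-cong {ℕ.suc n} f≗g = cong₂ _+_ (f≗g zero) (Σℚ-cong (λ i → f≗g (suc i)))

Σℚ-zero : ∀ {n} {f : Fin n → ℚ} → (∀ i → f i ≡ 0ℚ) → Σℚ f ≡ 0ℚ
Σℚ-zero {ℕ.zero}  _    = refl
Σℚ-zero {ℕ.suc n} f≗0 = cong₂ _+_ (f≗0 zero) (Σℚ-zero (λ i → f≗0 (suc i)))

Σℚ-distrib-+ : ∀ {n} (f g : Fin n → ℚ) → Σℚ (λ i → f i + g i) ≡ Σℚ f + Σℚ g
Σℚ-distrib-+ f g rewrite Σℚ≡sum (λ i → f i + g i) | Σℚ≡sum f | Σℚ≡sum g = ∑-distrib-+ f g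

Σℚ-distribˡ-* : ∀ {n} (c : ℚ) (f : Fin n → ℚ) → Σℚ (λ i → c * f i) ≡ c * Σℚ f
Σℚ-distribˡ-* c f rewrite Σℚ≡sum (λ i → c * f i) | Σℚ≡sum f = sym (*-distribˡ-sum c f)

Σℚ-comm : ∀ {m n} (f : Fin m → Fin n → ℚ) →
          Σℚ (λ i → Σℚ (λ j → f i j)) ≡ Σℚ (λ j → Σℚ (λ i → f i j))
Σℚ-comm f = begin
  Σℚ (λ i → Σℚ (f i))                ≡⟨ Σℚ-cong (λ i → Σℚ≡sum (f i)) ⟩
  Σℚ (λ i → sum (f i))               ≡⟨ Σℚ≡sum (λ i → sum (f i)) ⟩
  sum (λ i → sum (f i))              ≡⟨ ∑-comm f ⟩
  sum (λ j → sum (λ i → f i j))      ≡⟨ Σℚ≡sum (λ j → sum (λ i → f i j)) ⟨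
  Σℚ (λ j → sum (λ i → f i j))       ≡⟨ Σℚ-cong (λ j → Σℚ≡sum (λ i → f i j)) ⟨
  Σℚ (λ j → Σℚ (λ i → f i j))        ∎
  where open ≡-Reasoning

Σℚ-single : ∀ {n} {f : Fin n → ℚ} (p : Fin n) → (∀ i → i ≢ p → f i ≡ 0ℚ) → Σℚ f ≡ f p
Σℚ-single {ℕ.suc n} {f} zero    f≗0 =
  trans (cong (f zero +_) (Σℚ-zero (λ i → f≗0 (suc i) λ ()))) (+-identityʳ (f zero))
Σℚ-single {ℕ.suc n} {f} (suc p) f≗0 =
  trans (cong₂ _+_ (f≗0 zero λ ()) (Σℚ-single p (λ i i≢p → f≗0 (suc i) (i≢p ∘ Fin.suc-injective))))
        (+-identityˡ _)

Σℚ-mono-≤ : ∀ {n} {f g : Fin n → ℚ} → (∀ i → f i ≤ g i) → Σℚ f ≤ Σℚ g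
Σℚ-mono-≤ {ℕ.zero}  _   = ≤-refl
Σℚ-mono-≤ {ℕ.suc n} f≤g = +-mono-≤ (f≤g zero) (Σℚ-mono-≤ (λ i → f≤g (suc i)))

Σℚ-nonpos : ∀ {n} {f : Fin n → ℚ} → (∀ i → f i ≤ 0ℚ) → Σℚ f ≤ 0ℚ
Σℚ-nonpos {n} f≤0 = ≤-trans (Σℚ-mono-≤ f≤0) (≤-reflexive (Σℚ-zero {n} λ _ → refl))

Σℚ-nonpos-zero : ∀ {n} {f : Fin n → ℚ} → (∀ i → f i ≤ 0ℚ) → Σℚ f ≡ 0ℚ → ∀ i → f i ≡ 0ℚ
Σℚ-nonpos-zero {ℕ.suc n} {f} f≤0 Σ≡0 zero =
  nonpos-+-zero (f≤0 zero) (Σℚ-nonpos (λ i → f≤0 (suc i))) Σ≡0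
Σℚ-nonpos-zero {ℕ.suc n} {f} f≤0 Σ≡0 (suc i) =
  Σℚ-nonpos-zero (λ i → f≤0 (suc i))
    (nonpos-+-zero (Σℚ-nonpos (λ i → f≤0 (suc i))) (f≤0 zero) (trans (+-comm _ (f zero)) Σ≡0)) i

ΣΣ : ∀ {d} → (Fin d → Fin d → ℚ) → ℚ
ΣΣ f = Σℚ (λ p → Σℚ (λ q → f p q))

module _ {d : ℕ} where

  ΣΣ-cong : {f g : Fin d → Fin d → ℚ} → (∀ p q → f p q ≡ g p q) → ΣΣ f ≡ ΣΣ g
  ΣΣ-cong f≗g = Σℚ-cong (λ p → Σℚ-cong (f≗g p))

  ΣΣ-zero : {f : Fin d → Fin d → ℚ} → (∀ p q → f p q ≡ 0ℚ) → ΣΣ f ≡ 0ℚ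
  ΣΣ-zero f≗0 = Σℚ-zero (λ p → Σℚ-zero (f≗0 p))

  ΣΣ-distrib-+ : (f g : Fin d → Fin d → ℚ) → ΣΣ (λ p q → f p q + g p q) ≡ ΣΣ f + ΣΣ g
  ΣΣ-distrib-+ f g =
    trans (Σℚ-cong (λ p → Σℚ-distrib-+ (f p) (g p))) (Σℚ-distrib-+ (λ p → Σℚ (f p)) (λ p → Σℚ (g p)))

  ΣΣ-distribˡ-* : (c : ℚ) (f : Fin d → Fin d → ℚ) → ΣΣ (λ p q → c * f p q) ≡ c * ΣΣ f
  ΣΣ-distribˡ-* c f = trans (Σℚ-cong (λ p → Σℚ-distribˡ-* c (f p))) (Σℚ-distribˡ-* c (λ p → Σℚ (f p)))

  ΣΣ-nonpos-zero : {f : Fin d → Fin d → ℚ} → (∀ p q → f p q ≤ 0ℚ) → ΣΣ f ≡ 0ℚ → ∀ p q → f p q ≡ 0ℚ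
  ΣΣ-nonpos-zero f≤0 ΣΣ≡0 p =
    Σℚ-nonpos-zero (f≤0 p) (Σℚ-nonpos-zero (λ p → Σℚ-nonpos (f≤0 p)) ΣΣ≡0 p)

module _ {d : ℕ} where

  unit-diag : (i : Fin d) → unit i i ≡ 1ℚ
  unit-diag i with i Fin.≟ i
  ... | yes _   = refl
  ... | no i≢i = ⊥-elim (i≢i refl)

  unit-off : {i j : Fin d} → i ≢ j → unit i j ≡ 0ℚ
  unit-off {i} {j} i≢j with i Fin.≟ j
  ... | yes i≡j = ⊥-elim (i≢j i≡j)
  ... | no _    = refl

  Σℚ-unit : (i : Fin d) (f : Fin d → ℚ) → Σℚ (λ k → unit i k * f k) ≡ f i
  Σℚ-unit i f = trans
    (Σℚ-single i (λ k k≢i → trans (cong (_* f k) (unit-off (k≢i ∘ sym))) (*-zeroˡ (f k))))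
    (trans (cong (_* f i) (unit-diag i)) (*-identityˡ (f i)))

  lin-ρ : (w : Point d) (p q : Fin d) → lin w (ρ p q) ≡ w p + w q
  lin-ρ w p q = begin
    Σℚ (λ k → w k * (unit p k + unit q k))             ≡⟨ Σℚ-cong (λ k → spread (w k) (unit p k) (unit q k)) ⟩
    Σℚ (λ k → unit p k * w k + unit q k * w k)         ≡⟨ Σℚ-distrib-+ (λ k → unit p k * w k) (λ k → unit q k * w k) ⟩
    Σℚ (λ k → unit p k * w k) + Σℚ (λ k → unit q k * w k) ≡⟨ cong₂ _+_ (Σℚ-unit p w) (Σℚ-unit q w) ⟩
    w p + w q                                          ∎
    where
    open ≡-Reasoning
    spread : ∀ x y z → x * (y + z) ≡ y * x + z * x
    spread = solve-∀ ℚ-ring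

  _≟²_ : DecidableEquality (Fin d × Fin d)
  _≟²_ = ≡-dec Fin._≟_ Fin._≟_

  δ : Fin d → Fin d → Fin d → Fin d → ℚ
  δ u v p q = unit u p * unit v q

  δ-diag : (u v : Fin d) → δ u v u v ≡ 1ℚ
  δ-diag u v = cong₂ _*_ (unit-diag u) (unit-diag v)

  δ-off : {u v p q : Fin d} → (p , q) ≢ (u , v) → δ u v p q ≡ 0ℚ
  δ-off {u} {v} {p} {q} pq≢uv = by-cases (u Fin.≟ p) (v Fin.≟ q)
    where
    by-cases : Dec (u ≡ p) → Dec (v ≡ q) → δ u v p q ≡ 0ℚ
    by-cases (yes refl) (yes refl) = ⊥-elim (pq≢uv refl)
    by-cases (no u≢p)   _          = trans (cong (_* unit v q) (unit-off u≢p)) (*-zeroˡ (unit v q))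
    by-cases (yes _)    (no v≢q)   = trans (cong (unit u p *_) (unit-off v≢q)) (*-zeroʳ (unit u p))

  δ-nonneg : (u v p q : Fin d) → 0ℚ ≤ δ u v p q
  δ-nonneg u v p q with (p , q) ≟² (u , v)
  ... | yes refl  = ≤-trans (*≤* (ℤ.+≤+ ℕ.z≤n)) (≤-reflexive (sym (δ-diag u v)))
  ... | no pq≢uv = ≤-reflexive (sym (δ-off pq≢uv))

  ΣΣ-δ : (u v : Fin d) (g : Fin d → Fin d → ℚ) → ΣΣ (λ p q → δ u v p q * g p q) ≡ g u v
  ΣΣ-δ u v g = begin
    Σℚ (λ p → Σℚ (λ q → unit u p * unit v q * g p q))    ≡⟨ Σℚ-cong (λ p → trans
                                                             (Σℚ-cong (λ q → *-assoc (unit u p) (unit v q) (g p q)))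
                                                             (Σℚ-distribˡ-* (unit u p) (λ q → unit v q * g p q))) ⟩
    Σℚ (λ p → unit u p * Σℚ (λ q → unit v q * g p q))    ≡⟨ Σℚ-cong (λ p → cong (unit u p *_) (Σℚ-unit v (g p))) ⟩
    Σℚ (λ p → unit u p * g p v)                          ≡⟨ Σℚ-unit u (λ p → g p v) ⟩
    g u v                                                ∎
    where open ≡-Reasoning

  ΣΣ-extract : (u v : Fin d) (f : Fin d → Fin d → ℚ) →
               ΣΣ f ≡ f u v + ΣΣ (λ p q → f p q - δ u v p q * f u v)
  ΣΣ-extract u v f = begin
    ΣΣ f                         ≡⟨ ΣΣ-cong (λ p q → split (f p q) (peak p q)) ⟩
    ΣΣ (λ p q → peak p q + rest p q) ≡⟨ ΣΣ-distrib-+ peak rest ⟩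
    ΣΣ peak + ΣΣ rest            ≡⟨ cong (_+ ΣΣ rest) (ΣΣ-δ u v (λ _ _ → f u v)) ⟩
    f u v + ΣΣ rest              ∎
    where
    open ≡-Reasoning
    peak rest : Fin d → Fin d → ℚ
    peak p q = δ u v p q * f u v
    rest p q = f p q - peak p q
    split : ∀ x y → x ≡ y + (x - y)
    split = solve-∀ ℚ-ring

  sumOver : (Fin d → Fin d → ℚ) → List (Fin d × Fin d) → ℚ
  sumOver f = foldr (λ e s → uncurry f e + s) 0ℚ

  ΣΣ-support : (f : Fin d → Fin d → ℚ) (L : List (Fin d × Fin d)) → Unique L →
               (∀ p q → (p , q) ∉ L → f p q ≡ 0ℚ) → ΣΣ f ≡ sumOver f L
  ΣΣ-support f []             _              f≗0 = ΣΣ-zero (λ p q → f≗0 p q λ ())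
  ΣΣ-support f ((u , v) ∷ L) (uv∉L ∷ unique) f≗0 = begin
    ΣΣ f                 ≡⟨ ΣΣ-extract u v f ⟩
    f u v + ΣΣ f′        ≡⟨ cong (f u v +_) (ΣΣ-support f′ L unique f′≗0) ⟩
    f u v + sumOver f′ L ≡⟨ cong (f u v +_) (agree L uv∉L) ⟩
    f u v + sumOver f L  ∎
    where
    open ≡-Reasoning
    f′ : Fin d → Fin d → ℚ
    f′ p q = f p q - δ u v p q * f u v

    f′-off : ∀ {p q} → (p , q) ≢ (u , v) → f′ p q ≡ f p q
    f′-off {p} {q} pq≢uv = trans (cong (λ z → f p q - z * f u v) (δ-off pq≢uv)) (drop (f p q) (f u v))
      where
      drop : ∀ x y → x - 0ℚ * y ≡ x
      drop = solve-∀ ℚ-ring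

    f′≗0 : ∀ p q → (p , q) ∉ L → f′ p q ≡ 0ℚ
    f′≗0 p q pq∉L with (p , q) ≟² (u , v)
    ... | yes refl  = trans (cong (λ z → f u v - z * f u v) (δ-diag u v)) (cancel (f u v))
      where
      cancel : ∀ x → x - 1ℚ * x ≡ 0ℚ
      cancel = solve-∀ ℚ-ring
    ... | no pq≢uv = trans (f′-off pq≢uv) (f≗0 p q λ { (here e) → pq≢uv e ; (there e) → pq∉L e })

    agree : ∀ M → All (λ e → (u , v) ≢ e) M → sumOver f′ M ≡ sumOver f M
    agree []            []             = refl
    agree ((p , q) ∷ M) (uv≢pq ∷ rest) = cong₂ _+_ (f′-off (uv≢pq ∘ sym)) (agree M rest)

-- Linear forms

Adj⇒≢ : ∀ {d} (G : SimpleGraph d) {p q : Fin d} → Adj G p q ≡ true → p ≢ q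
Adj⇒≢ G {p} pq∈E refl with trans (sym pq∈E) (irrefl G p)
... | ()

Adj-sym : ∀ {d} (G : SimpleGraph d) {p q : Fin d} → Adj G p q ≡ true → Adj G q p ≡ true
Adj-sym G {p} {q} pq∈E = trans (SimpleGraph.sym G q p) pq∈E

edge≢non-edge : ∀ {d} (G : SimpleGraph d) {p q : Fin d} → Adj G p q ≡ true → Adj G p q ≢ false
edge≢non-edge G pq∈E pq∉E with trans (sym pq∈E) pq∉E
... | ()

lin-convex : ∀ {d} (w x : Point d) (λw : Fin d → Fin d → ℚ) →
             (∀ k → x k ≡ ΣΣ (λ p q → λw p q * ρ p q k)) →
             lin w x ≡ ΣΣ (λ p q → λw p q * (w p + w q))
lin-convex w x λw x≡ = begin
  Σℚ (λ k → w k * x k)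
    ≡⟨ Σℚ-cong (λ k → trans (cong (w k *_) (x≡ k)) (sym (ΣΣ-distribˡ-* (w k) (λ p q → λw p q * ρ p q k)))) ⟩
  Σℚ (λ k → ΣΣ (λ p q → w k * (λw p q * ρ p q k)))
    ≡⟨ Σℚ-comm (λ k p → Σℚ (λ q → w k * (λw p q * ρ p q k))) ⟩
  Σℚ (λ p → Σℚ (λ k → Σℚ (λ q → w k * (λw p q * ρ p q k))))
    ≡⟨ Σℚ-cong (λ p → Σℚ-comm (λ k q → w k * (λw p q * ρ p q k))) ⟩
  ΣΣ (λ p q → Σℚ (λ k → w k * (λw p q * ρ p q k)))
    ≡⟨ ΣΣ-cong (λ p q → trans (Σℚ-cong (λ k → reorder (w k) (λw p q) (ρ p q k)))
                              (Σℚ-distribˡ-* (λw p q) (λ k → w k * ρ p q k))) ⟩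
  ΣΣ (λ p q → λw p q * lin w (ρ p q))
    ≡⟨ ΣΣ-cong (λ p q → cong (λw p q *_) (lin-ρ w p q)) ⟩
  ΣΣ (λ p q → λw p q * (w p + w q))
    ∎
  where
  open ≡-Reasoning
  reorder : ∀ x y z → x * (y * z) ≡ y * (x * z)
  reorder = solve-∀ ℚ-ring

module EdgeWeights {d : ℕ} (G : SimpleGraph d) (λw : Fin d → Fin d → ℚ)
  (λ≥0 : ∀ p q → 0ℚ ≤ λw p q) (λ-edge : ∀ p q → λw p q ≢ 0ℚ → Adj G p q ≡ true) where

  weighted-term-mono : {g h : Fin d → Fin d → ℚ} → (∀ p q → Adj G p q ≡ true → g p q ≤ h p q) →
                       ∀ p q → λw p q * g p q ≤ λw p q * h p q
  weighted-term-mono {g} {h} g≤h p q with λw p q ≟ 0ℚ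
  ... | yes λ≡0 = ≤-reflexive (trans (cong (_* g p q) λ≡0)
                              (trans (*-zeroˡ (g p q)) (sym (trans (cong (_* h p q) λ≡0) (*-zeroˡ (h p q))))))
  ... | no λ≢0  = *-monoˡ-≤-nonNeg (λw p q) {{nonNegative (λ≥0 p q)}} (g≤h p q (λ-edge p q λ≢0))

  weighted-mono : {g h : Fin d → Fin d → ℚ} → (∀ p q → Adj G p q ≡ true → g p q ≤ h p q) →
                  ΣΣ (λ p q → λw p q * g p q) ≤ ΣΣ (λ p q → λw p q * h p q)
  weighted-mono g≤h = Σℚ-mono-≤ (λ p → Σℚ-mono-≤ (weighted-term-mono g≤h p))

  weighted-cong : {g h : Fin d → Fin d → ℚ} → (∀ p q → Adj G p q ≡ true → g p q ≡ h p q) →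
                  ΣΣ (λ p q → λw p q * g p q) ≡ ΣΣ (λ p q → λw p q * h p q)
  weighted-cong g≡h = ≤-antisym (weighted-mono (λ p q e → ≤-reflexive (g≡h p q e)))
                                (weighted-mono (λ p q e → ≤-reflexive (sym (g≡h p q e))))

  weighted-const : ΣΣ λw ≡ 1ℚ → (M : ℚ) → ΣΣ (λ p q → λw p q * M) ≡ M
  weighted-const total M = begin
    ΣΣ (λ p q → λw p q * M) ≡⟨ ΣΣ-cong (λ p q → *-comm (λw p q) M) ⟩
    ΣΣ (λ p q → M * λw p q) ≡⟨ ΣΣ-distribˡ-* M λw ⟩
    M * ΣΣ λw               ≡⟨ cong (M *_) total ⟩
    M * 1ℚ                  ≡⟨ *-identityʳ M ⟩
    M                       ∎
    where open ≡-Reasoning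

module _ {d : ℕ} (G : SimpleGraph d) where

  lin≤-EdgePolytope : (w : Point d) (M : ℚ) → (∀ p q → Adj G p q ≡ true → w p + w q ≤ M) →
                      ∀ x → EdgePolytope G x → lin w x ≤ M
  lin≤-EdgePolytope w M edge≤M x (λw , λ≥0 , λ-edge , total , x≡) = begin
    lin w x                           ≡⟨ lin-convex w x λw x≡ ⟩
    ΣΣ (λ p q → λw p q * (w p + w q)) ≤⟨ weighted-mono edge≤M ⟩
    ΣΣ (λ p q → λw p q * M)           ≡⟨ weighted-const total M ⟩
    M                                 ∎
    where
    open ≤-Reasoning
    open EdgeWeights G λw λ≥0 λ-edge

  lin-proportional : (w w′ : Point d) (μ : ℚ) →
                     (∀ p q → Adj G p q ≡ true → w p + w q ≡ μ * (w′ p + w′ q)) →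
                     ∀ x → EdgePolytope G x → lin w x ≡ μ * lin w′ x
  lin-proportional w w′ μ edge≡ x (λw , λ≥0 , λ-edge , _ , x≡) = begin
    lin w x                                  ≡⟨ lin-convex w x λw x≡ ⟩
    ΣΣ (λ p q → λw p q * (w p + w q))        ≡⟨ weighted-cong edge≡ ⟩
    ΣΣ (λ p q → λw p q * (μ * (w′ p + w′ q))) ≡⟨ ΣΣ-cong (λ p q → reorder (λw p q) μ (w′ p + w′ q)) ⟩
    ΣΣ (λ p q → μ * (λw p q * (w′ p + w′ q))) ≡⟨ ΣΣ-distribˡ-* μ (λ p q → λw p q * (w′ p + w′ q)) ⟩
    μ * ΣΣ (λ p q → λw p q * (w′ p + w′ q))   ≡⟨ cong (μ *_) (lin-convex w′ x λw x≡) ⟨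
    μ * lin w′ x                             ∎
    where
    open ≡-Reasoning
    open EdgeWeights G λw λ≥0 λ-edge
    reorder : ∀ x y z → x * (y * z) ≡ y * (x * z)
    reorder = solve-∀ ℚ-ring

module _ {d : ℕ} where

  lin-cong : (a : Point d) {x y : Point d} → (∀ k → x k ≡ y k) → lin a x ≡ lin a y
  lin-cong a x≗y = Σℚ-cong (λ k → cong (a k *_) (x≗y k))

  lin-combination : (a y z : Point d) (s t : ℚ) →
                    lin a (λ k → s * y k + t * z k) ≡ s * lin a y + t * lin a z
  lin-combination a y z s t = begin
    Σℚ (λ k → a k * (s * y k + t * z k))             ≡⟨ Σℚ-cong (λ k → expand (a k) (y k) (z k) s t) ⟩
    Σℚ (λ k → s * (a k * y k) + t * (a k * z k))     ≡⟨ Σℚ-distrib-+ (λ k → s * (a k * y k)) (λ k → t * (a k * z k)) ⟩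
    Σℚ (λ k → s * (a k * y k)) + Σℚ (λ k → t * (a k * z k))
                                                     ≡⟨ cong₂ _+_ (Σℚ-distribˡ-* s (λ k → a k * y k))
                                                                  (Σℚ-distribˡ-* t (λ k → a k * z k)) ⟩
    s * lin a y + t * lin a z                        ∎
    where
    open ≡-Reasoning
    expand : ∀ α u v σ τ → α * (σ * u + τ * v) ≡ σ * (α * u) + τ * (α * v)
    expand = solve-∀ ℚ-ring

  lin-midpoint-zero : (u : Point d) {x y z : Point d} → (∀ m → x m ≡ ½ * (y m + z m)) →
                      lin u x ≡ 0ℚ → lin u y + lin u z ≡ 0ℚ
  lin-midpoint-zero u {x} {y} {z} x≡mid ux≡0 = begin
    lin u y + lin u z                       ≡⟨ double-half (lin u y) (lin u z) ⟩
    (1ℚ + 1ℚ) * (½ * lin u y + ½ * lin u z) ≡⟨ cong ((1ℚ + 1ℚ) *_) (lin-combination u y z ½ ½) ⟨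
    (1ℚ + 1ℚ) * lin u (λ m → ½ * y m + ½ * z m)
                                            ≡⟨ cong ((1ℚ + 1ℚ) *_) (lin-cong u (λ m → trans (x≡mid m)
                                                                            (*-distribˡ-+ ½ (y m) (z m)))) ⟨
    (1ℚ + 1ℚ) * lin u x                     ≡⟨ cong ((1ℚ + 1ℚ) *_) ux≡0 ⟩
    (1ℚ + 1ℚ) * 0ℚ                          ≡⟨ *-zeroʳ (1ℚ + 1ℚ) ⟩
    0ℚ                                      ∎
    where
    open ≡-Reasoning
    double-half : ∀ Y Z → Y + Z ≡ (1ℚ + 1ℚ) * (½ * Y + ½ * Z)
    double-half = solve-∀ ℚ-ring

  lin-neg : (a x : Point d) → lin (λ k → - a k) x ≡ - lin a x
  lin-neg a x = begin
    Σℚ (λ k → - a k * x k)          ≡⟨ Σℚ-cong (λ k → neg-as-scale (a k) (x k)) ⟩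
    Σℚ (λ k → - 1ℚ * (a k * x k))   ≡⟨ Σℚ-distribˡ-* (- 1ℚ) (λ k → a k * x k) ⟩
    - 1ℚ * lin a x                  ≡⟨ -1*x≈-x (lin a x) ⟩
    - lin a x                       ∎
    where
    open ≡-Reasoning
    neg-as-scale : ∀ u v → - u * v ≡ - 1ℚ * (u * v)
    neg-as-scale = solve-∀ ℚ-ring

  relInt-nonpos⇒zero : {P : Subset d} {a x₀ : Point d} → RelInt P x₀ → lin a x₀ ≡ 0ℚ →
                       (∀ y → P y → lin a y ≤ 0ℚ) → ∀ y → P y → lin a y ≡ 0ℚ
  relInt-nonpos⇒zero {P} {a} {x₀} (_ , extend) ax₀≡0 a≤0 y y∈P with extend y y∈P
  ... | ε , ε>0 , z∈P = ≤-antisym (a≤0 y y∈P) (*-cancelˡ-≤-pos ε {{positive ε>0}} (begin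
    ε * 0ℚ                  ≡⟨ *-zeroʳ ε ⟩
    0ℚ                      ≤⟨ neg-antimono-≤ (a≤0 z z∈P) ⟩
    - lin a z               ≡⟨ cong -_ (trans (lin-cong a (λ k → as-combination (x₀ k) (y k) ε))
                                              (lin-combination a x₀ y (1ℚ + ε) (- ε))) ⟩
    - ((1ℚ + ε) * lin a x₀ + - ε * lin a y) ≡⟨ cong (λ u → - ((1ℚ + ε) * u + - ε * lin a y)) ax₀≡0 ⟩
    - ((1ℚ + ε) * 0ℚ + - ε * lin a y)       ≡⟨ simplify (lin a y) ε ⟩
    ε * lin a y             ∎))
    where
    open ≤-Reasoning
    z : Point d
    z k = x₀ k + ε * (x₀ k - y k)
    as-combination : ∀ u v e → u + e * (u - v) ≡ (1ℚ + e) * u + - e * v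
    as-combination = solve-∀ ℚ-ring
    simplify : ∀ u e → - ((1ℚ + e) * 0ℚ + - e * u) ≡ e * u
    simplify = solve-∀ ℚ-ring

  Integral-≐ : {P Q : Subset d} → P ≐ Q → Integral P → Integral Q
  Integral-≐ P≐Q P-integral x (x∈Q , extreme) =
    P-integral x (proj₂ (P≐Q x) x∈Q , λ y z y∈P z∈P → extreme y z (proj₁ (P≐Q y) y∈P) (proj₁ (P≐Q z) z∈P))

module _ {μ : ℚ} (μ>0 : 0ℚ < μ) where

  private instance
    μ-positive = positive μ>0

  *-nonneg⁺ : ∀ {q} → 0ℚ ≤ q → 0ℚ ≤ μ * q
  *-nonneg⁺ {q} 0≤q = ≤-trans (≤-reflexive (sym (*-zeroʳ μ))) (*-monoˡ-≤-nonNeg μ {{pos⇒nonNeg μ}} 0≤q)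

  *-nonpos⁺ : ∀ {q} → q ≤ 0ℚ → μ * q ≤ 0ℚ
  *-nonpos⁺ {q} q≤0 = ≤-trans (*-monoˡ-≤-nonNeg μ {{pos⇒nonNeg μ}} q≤0) (≤-reflexive (*-zeroʳ μ))

  *-nonneg⁻ : ∀ {q} → 0ℚ ≤ μ * q → 0ℚ ≤ q
  *-nonneg⁻ {q} 0≤μq = *-cancelˡ-≤-pos μ (≤-trans (≤-reflexive (*-zeroʳ μ)) 0≤μq)

  *-nonpos⁻ : ∀ {q} → μ * q ≤ 0ℚ → q ≤ 0ℚ
  *-nonpos⁻ {q} μq≤0 = *-cancelˡ-≤-pos μ (≤-trans μq≤0 (≤-reflexive (sym (*-zeroʳ μ))))

  *-zero⁻ : ∀ {q} → μ * q ≡ 0ℚ → q ≡ 0ℚ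
  *-zero⁻ μq≡0 = ≤-antisym (*-nonpos⁻ (≤-reflexive μq≡0)) (*-nonneg⁻ (≤-reflexive (sym μq≡0)))

  rescale-separating : ∀ {d} {P : Subset d} {a a′ : Point d} →
                       (∀ x → P x → lin a x ≡ μ * lin a′ x) →
                       Separating P a → Separating P a′ × SameDecomposition P a a′
  rescale-separating {P = P} {a} {a′} a≡μa′ ((x₀ , x₀∈ri , ax₀≡0) , nontrivial , int⁺ , int⁻) =
    ( (x₀ , x₀∈ri , *-zero⁻ (trans (sym (a≡μa′ x₀ (proj₁ x₀∈ri))) ax₀≡0))
    , (λ a′≡0 → nontrivial (λ x x∈P → trans (a≡μa′ x x∈P) (trans (cong (μ *_) (a′≡0 x x∈P)) (*-zeroʳ μ))))
    , Integral-≐ same⁺ int⁺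
    , Integral-≐ same⁻ int⁻ )
    , inj₁ (swap ∘ same⁺ , swap ∘ same⁻)
    where
    same⁺ : (P ∩H⁺ a) ≐ (P ∩H⁺ a′)
    same⁺ x = (λ (x∈P , 0≤a) → x∈P , *-nonneg⁻ (subst (0ℚ ≤_) (a≡μa′ x x∈P) 0≤a))
            , (λ (x∈P , 0≤a′) → x∈P , subst (0ℚ ≤_) (sym (a≡μa′ x x∈P)) (*-nonneg⁺ 0≤a′))
    same⁻ : (P ∩H⁻ a) ≐ (P ∩H⁻ a′)
    same⁻ x = (λ (x∈P , a≤0) → x∈P , *-nonpos⁻ (subst (_≤ 0ℚ) (a≡μa′ x x∈P) a≤0))
            , (λ (x∈P , a′≤0) → x∈P , subst (_≤ 0ℚ) (sym (a≡μa′ x x∈P)) (*-nonpos⁺ a′≤0))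

EdgeWith : ∀ {d} → SimpleGraph d → Point d → (ℚ → Set) → Set
EdgeWith {d} G a P = Σ (Fin d) λ p → Σ (Fin d) λ q → Adj G p q ≡ true × P (a p + a q)

module _ {d : ℕ} (G : SimpleGraph d) where

  positive-edge : (a : Point d) {x₀ : Point d} → RelInt (EdgePolytope G) x₀ → lin a x₀ ≡ 0ℚ →
                  ¬ (∀ x → EdgePolytope G x → lin a x ≡ 0ℚ) → EdgeWith G a (0ℚ <_)
  positive-edge a x₀∈ri ax₀≡0 nontrivial
    with Fin.any? (λ p → Fin.any? (λ q → Adj G p q Bool.≟ true ×-dec 0ℚ <? a p + a q))
  ... | yes (p , q , pq∈E , pq>0) = p , q , pq∈E , pq>0
  ... | no none = ⊥-elim (nontrivial (relInt-nonpos⇒zero {a = a} x₀∈ri ax₀≡0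
                    (lin≤-EdgePolytope G a 0ℚ (λ p q pq∈E → ≮⇒≥ (λ pq>0 → none (p , q , pq∈E , pq>0))))))

  negative-edge : (a : Point d) {x₀ : Point d} → RelInt (EdgePolytope G) x₀ → lin a x₀ ≡ 0ℚ →
                  ¬ (∀ x → EdgePolytope G x → lin a x ≡ 0ℚ) → EdgeWith G a (_< 0ℚ)
  negative-edge a {x₀} x₀∈ri ax₀≡0 nontrivial =
    negate (positive-edge −a x₀∈ri −ax₀≡0 −a-nontrivial)
    where
    −a : Point d
    −a k = - a k
    −ax₀≡0 : lin −a x₀ ≡ 0ℚ
    −ax₀≡0 = trans (lin-neg a x₀) (cong -_ ax₀≡0)
    −a-nontrivial : ¬ (∀ x → EdgePolytope G x → lin −a x ≡ 0ℚ)
    −a-nontrivial −a≡0 = nontrivial (λ x x∈P → neg-injective (trans (sym (lin-neg a x)) (−a≡0 x x∈P)))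
    negate : EdgeWith G −a (0ℚ <_) → EdgeWith G a (_< 0ℚ)
    negate (p , q , pq∈E , −pq>0) =
      p , q , pq∈E , subst (_< 0ℚ) (⁻¹-involutive (a p + a q))
                       (neg-antimono-< (subst (0ℚ <_) (sym (neg-distrib-+ (a p) (a q))) −pq>0))

-- Crossing faces

¬integer-between-0-and-1 : ∀ {q} → IsIntegerℚ q → 0ℚ < q → q < 1ℚ → ⊥
¬integer-between-0-and-1 (z , refl) 0<q q<1 = gap {↥ (z / 1)} ↧≡1 (drop-*<* 0<q) (drop-*<* q<1)
  where
  ↧≡1 : ↧ (z / 1) ≡ ℤ.+ 1
  ↧≡1 = trans (sym (ℤ.*-identityʳ (↧ (z / 1))))
              (trans (cong (↧ (z / 1) ℤ.*_) (sym (gcd-zeroʳ z))) (↧-/ z 1))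
  between : ∀ {m} → ℤ.+ 0 ℤ.< m → m ℤ.< ℤ.+ 1 → ⊥
  between {ℤ.+ 0}      (ℤ.+<+ ()) _
  between {ℤ.+[1+ _ ]} _         (ℤ.+<+ (ℕ.s≤s ()))
  gap : ∀ {m d} → d ≡ ℤ.+ 1 → ℤ.+ 0 ℤ.* d ℤ.< m ℤ.* ℤ.+ 1 → m ℤ.* ℤ.+ 1 ℤ.< ℤ.+ 1 ℤ.* d → ⊥
  gap {m} refl lo hi = between (subst (ℤ.+ 0 ℤ.<_) (ℤ.*-identityʳ m) lo)
                               (subst (ℤ._< ℤ.+ 1) (ℤ.*-identityʳ m) hi)

orientations : ∀ {d} → Fin d → Fin d → Fin d → Fin d → List (Fin d × Fin d)
orientations i j k l = (i , j) ∷ (j , i) ∷ (k , l) ∷ (l , k) ∷ []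

-- When w is non-positive on edges and vanishes exactly on ij and kl, the segment from ρ(kl)
-- to ρ(ij) is a face of P_G; its point x on H is then a vertex of P_G ∩ H⁺ with x i = t ∈ (0, 1).
module CrossingFace {d : ℕ} (G : SimpleGraph d) (a w : Point d) {i j k l : Fin d}
  (ij∈E : Adj G i j ≡ true) (kl∈E : Adj G k l ≡ true)
  (ij>0 : 0ℚ < a i + a j) (kl<0 : a k + a l < 0ℚ) (i≢k : i ≢ k) (i≢l : i ≢ l)
  (w-ij : w i + w j ≡ 0ℚ) (w-kl : w k + w l ≡ 0ℚ)
  (w<0 : ∀ p q → Adj G p q ≡ true → (p , q) ∉ orientations i j k l → w p + w q < 0ℚ) where

  open import Data.List.Membership.DecPropositional (_≟²_ {d}) using (_∈?_)

  v⁺ v⁻ Δ : ℚ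
  v⁺ = a i + a j
  v⁻ = a k + a l
  Δ  = v⁺ - v⁻

  Δ>0 : 0ℚ < Δ
  Δ>0 = <-≤-trans (+-mono-< ij>0 (neg-antimono-< kl<0)) ≤-refl

  private instance
    Δ≢0 : NonZero Δ
    Δ≢0 = pos⇒nonZero Δ {{positive Δ>0}}

  t : ℚ
  t = - v⁻ * 1/ Δ

  t*Δ : t * Δ ≡ - v⁻
  t*Δ = trans (*-assoc (- v⁻) (1/ Δ) Δ) (trans (cong (- v⁻ *_) (*-inverseˡ Δ)) (*-identityʳ (- v⁻)))

  crossing : ∀ s → s * v⁺ + (1ℚ - s) * v⁻ ≡ Δ * (s - t)
  crossing s = begin
    s * v⁺ + (1ℚ - s) * v⁻     ≡⟨ expand s t v⁺ v⁻ ⟩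
    Δ * (s - t) + (t * Δ + v⁻) ≡⟨ cong (λ u → Δ * (s - t) + (u + v⁻)) t*Δ ⟩
    Δ * (s - t) + (- v⁻ + v⁻)  ≡⟨ cong (Δ * (s - t) +_) (+-inverseˡ v⁻) ⟩
    Δ * (s - t) + 0ℚ           ≡⟨ +-identityʳ (Δ * (s - t)) ⟩
    Δ * (s - t)                ∎
    where
    open ≡-Reasoning
    expand : ∀ s t p m → s * p + (1ℚ - s) * m ≡ (p - m) * (s - t) + (t * (p - m) + m)
    expand = solve-∀ ℚ-ring

  t-crosses : t * v⁺ + (1ℚ - t) * v⁻ ≡ 0ℚ
  t-crosses = trans (crossing t) (trans (cong (Δ *_) (+-inverseʳ t)) (*-zeroʳ Δ))

  crossing-unique : ∀ s → s * v⁺ + (1ℚ - s) * v⁻ ≡ 0ℚ → s ≡ t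
  crossing-unique s crosses = begin
    s           ≡⟨ split s t ⟩
    (s - t) + t ≡⟨ cong (_+ t) (*-zero⁻ Δ>0 (trans (sym (crossing s)) crosses)) ⟩
    0ℚ + t      ≡⟨ +-identityˡ t ⟩
    t           ∎
    where
    open ≡-Reasoning
    split : ∀ s t → s ≡ (s - t) + t
    split = solve-∀ ℚ-ring

  0<t : 0ℚ < t
  0<t = positive⁻¹ t {{pos*pos⇒pos (- v⁻) {{positive (neg-antimono-< kl<0)}} (1/ Δ)
                                    {{1/pos⇒pos Δ {{positive Δ>0}}}}}}

  t<1 : t < 1ℚ
  t<1 = *-cancelʳ-<-nonNeg Δ {{nonNegative (<⇒≤ Δ>0)}} (begin-strict
    t * Δ     ≡⟨ t*Δ ⟩
    - v⁻      ≡⟨ +-identityˡ (- v⁻) ⟨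
    0ℚ + - v⁻ <⟨ +-monoˡ-< (- v⁻) ij>0 ⟩
    Δ         ≡⟨ *-identityˡ Δ ⟨
    1ℚ * Δ    ∎)
    where open ≤-Reasoning

  segment : Fin d → Fin d → ℚ
  segment p q = t * δ i j p q + (1ℚ - t) * δ k l p q

  segment-sum : ∀ g → ΣΣ (λ p q → segment p q * g p q) ≡ t * g i j + (1ℚ - t) * g k l
  segment-sum g = begin
    ΣΣ (λ p q → segment p q * g p q)
      ≡⟨ ΣΣ-cong (λ p q → distrib t (δ i j p q) (δ k l p q) (g p q)) ⟩
    ΣΣ (λ p q → t * (δ i j p q * g p q) + (1ℚ - t) * (δ k l p q * g p q))
      ≡⟨ ΣΣ-distrib-+ (λ p q → t * (δ i j p q * g p q)) (λ p q → (1ℚ - t) * (δ k l p q * g p q)) ⟩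
    ΣΣ (λ p q → t * (δ i j p q * g p q)) + ΣΣ (λ p q → (1ℚ - t) * (δ k l p q * g p q))
      ≡⟨ cong₂ _+_ (ΣΣ-distribˡ-* t (λ p q → δ i j p q * g p q))
                   (ΣΣ-distribˡ-* (1ℚ - t) (λ p q → δ k l p q * g p q)) ⟩
    t * ΣΣ (λ p q → δ i j p q * g p q) + (1ℚ - t) * ΣΣ (λ p q → δ k l p q * g p q)
      ≡⟨ cong₂ (λ u v → t * u + (1ℚ - t) * v) (ΣΣ-δ i j g) (ΣΣ-δ k l g) ⟩
    t * g i j + (1ℚ - t) * g k l
      ∎
    where
    open ≡-Reasoning
    distrib : ∀ t x y g → (t * x + (1ℚ - t) * y) * g ≡ t * (x * g) + (1ℚ - t) * (y * g)
    distrib = solve-∀ ℚ-ring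

  x : Point d
  x m = t * ρ i j m + (1ℚ - t) * ρ k l m

  x∈P : EdgePolytope G x
  x∈P = segment , segment≥0 , segment-edge , total , (λ m → sym (segment-sum (λ p q → ρ p q m)))
    where
    nonneg*nonneg : ∀ {u v} → 0ℚ ≤ u → 0ℚ ≤ v → 0ℚ ≤ u * v
    nonneg*nonneg {u} {v} 0≤u 0≤v =
      nonNegative⁻¹ (u * v) {{nonNeg*nonNeg⇒nonNeg u {{nonNegative 0≤u}} v {{nonNegative 0≤v}}}}
    1-t≥0 : 0ℚ ≤ 1ℚ - t
    1-t≥0 = ≤-trans (≤-reflexive (sym (+-inverseʳ t))) (+-monoˡ-≤ (- t) (<⇒≤ t<1))
    segment≥0 : ∀ p q → 0ℚ ≤ segment p q
    segment≥0 p q = ≤-trans (≤-reflexive (sym (+-identityʳ 0ℚ)))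
                            (+-mono-≤ (nonneg*nonneg (<⇒≤ 0<t) (δ-nonneg i j p q))
                                      (nonneg*nonneg 1-t≥0 (δ-nonneg k l p q)))
    vanish : ∀ t → t * 0ℚ + (1ℚ - t) * 0ℚ ≡ 0ℚ
    vanish = solve-∀ ℚ-ring
    segment-edge : ∀ p q → segment p q ≢ 0ℚ → Adj G p q ≡ true
    segment-edge p q seg≢0 with (p , q) ≟² (i , j) | (p , q) ≟² (k , l)
    ... | yes refl | _        = ij∈E
    ... | no _     | yes refl = kl∈E
    ... | no pq≢ij | no pq≢kl =
      ⊥-elim (seg≢0 (trans (cong₂ (λ u v → t * u + (1ℚ - t) * v) (δ-off pq≢ij) (δ-off pq≢kl)) (vanish t)))
    affine-one : ∀ t → t * 1ℚ + (1ℚ - t) * 1ℚ ≡ 1ℚ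
    affine-one = solve-∀ ℚ-ring
    total : ΣΣ segment ≡ 1ℚ
    total = trans (ΣΣ-cong (λ p q → sym (*-identityʳ (segment p q))))
                  (trans (segment-sum (λ _ _ → 1ℚ)) (affine-one t))

  lin-x : ∀ u → lin u x ≡ t * (u i + u j) + (1ℚ - t) * (u k + u l)
  lin-x u = trans (lin-convex u x segment (λ m → sym (segment-sum (λ p q → ρ p q m))))
                  (segment-sum (λ p q → u p + u q))

  x-i : x i ≡ t
  x-i = begin
    t * (unit i i + unit j i) + (1ℚ - t) * (unit k i + unit l i)
      ≡⟨ cong₂ (λ u v → t * u + (1ℚ - t) * v) (cong₂ _+_ (unit-diag i) (unit-off (Adj⇒≢ G ij∈E ∘ sym)))
                                              (cong₂ _+_ (unit-off (i≢k ∘ sym)) (unit-off (i≢l ∘ sym))) ⟩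
    t * (1ℚ + 0ℚ) + (1ℚ - t) * (0ℚ + 0ℚ)
      ≡⟨ pick t ⟩
    t ∎
    where
    open ≡-Reasoning
    pick : ∀ t → t * (1ℚ + 0ℚ) + (1ℚ - t) * (0ℚ + 0ℚ) ≡ t
    pick = solve-∀ ℚ-ring

  a-x : lin a x ≡ 0ℚ
  a-x = trans (lin-x a) t-crosses

  w-x : lin w x ≡ 0ℚ
  w-x = trans (lin-x w) (trans (cong₂ (λ u v → t * u + (1ℚ - t) * v) w-ij w-kl) (vanish t))
    where
    vanish : ∀ t → t * 0ℚ + (1ℚ - t) * 0ℚ ≡ 0ℚ
    vanish = solve-∀ ℚ-ring

  w-orientations : ∀ {p q} → (p , q) ∈ orientations i j k l → w p + w q ≡ 0ℚ
  w-orientations (here refl)                         = w-ij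
  w-orientations (there (here refl))                 = trans (+-comm (w j) (w i)) w-ij
  w-orientations (there (there (here refl)))         = w-kl
  w-orientations (there (there (there (here refl)))) = trans (+-comm (w l) (w k)) w-kl

  w≤0 : ∀ p q → Adj G p q ≡ true → w p + w q ≤ 0ℚ
  w≤0 p q pq∈E with (p , q) ∈? orientations i j k l
  ... | yes pq∈ = ≤-reflexive (w-orientations pq∈)
  ... | no pq∉  = <⇒≤ (w<0 p q pq∈E pq∉)

  orientations-unique : Unique (orientations i j k l)
  orientations-unique =
      (i≢j ∘ ,-injectiveˡ ∷ i≢k ∘ ,-injectiveˡ ∷ i≢l ∘ ,-injectiveˡ ∷ [])
    ∷ (i≢l ∘ ,-injectiveʳ ∷ i≢k ∘ ,-injectiveʳ ∷ [])
    ∷ (Adj⇒≢ G kl∈E ∘ ,-injectiveˡ ∷ [])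
    ∷ [] ∷ []
    where
    i≢j = Adj⇒≢ G ij∈E

  on-face : ∀ {y} → EdgePolytope G y → lin w y ≡ 0ℚ → lin a y ≡ 0ℚ → ∀ m → y m ≡ x m
  on-face {y} (λy , λ≥0 , λ-edge , total , y≡) wy≡0 ay≡0 m = begin
    y m                                  ≡⟨ y≡ m ⟩
    ΣΣ (λ p q → λy p q * ρ p q m)        ≡⟨ restrict (λ p q → ρ p q m) (λ p q → +-comm (unit p m) (unit q m)) ⟩
    s * ρ i j m + s′ * ρ k l m           ≡⟨ cong₂ (λ u v → u * ρ i j m + v * ρ k l m) s≡t (trans s′≡1-s (cong (λ u → 1ℚ - u) s≡t)) ⟩
    t * ρ i j m + (1ℚ - t) * ρ k l m     ∎
    where
    open ≡-Reasoning
    open EdgeWeights G λy λ≥0 λ-edge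

    term≡0 : ∀ p q → λy p q * (w p + w q) ≡ 0ℚ
    term≡0 = ΣΣ-nonpos-zero
      (λ p q → ≤-trans (weighted-term-mono {h = λ _ _ → 0ℚ} w≤0 p q) (≤-reflexive (*-zeroʳ (λy p q))))
      (trans (sym (lin-convex w y λy y≡)) wy≡0)

    off-face : ∀ p q → (p , q) ∉ orientations i j k l → λy p q ≡ 0ℚ
    off-face p q pq∉ with λy p q ≟ 0ℚ
    ... | yes λ≡0 = λ≡0
    ... | no λ≢0  = nonneg*neg≡0 (λ≥0 p q) (w<0 p q (λ-edge p q λ≢0) pq∉) (term≡0 p q)

    s s′ : ℚ
    s  = λy i j + λy j i
    s′ = λy k l + λy l k

    restrict : ∀ g → (∀ p q → g p q ≡ g q p) → ΣΣ (λ p q → λy p q * g p q) ≡ s * g i j + s′ * g k l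
    restrict g g-sym = begin
      ΣΣ (λ p q → λy p q * g p q)
        ≡⟨ ΣΣ-support (λ p q → λy p q * g p q) (orientations i j k l) orientations-unique
                      (λ p q pq∉ → trans (cong (_* g p q) (off-face p q pq∉)) (*-zeroˡ (g p q))) ⟩
      λy i j * g i j + (λy j i * g j i + (λy k l * g k l + (λy l k * g l k + 0ℚ)))
        ≡⟨ cong₂ (λ u v → λy i j * g i j + (λy j i * u + (λy k l * g k l + (λy l k * v + 0ℚ))))
                 (g-sym j i) (g-sym l k) ⟩
      λy i j * g i j + (λy j i * g i j + (λy k l * g k l + (λy l k * g k l + 0ℚ)))
        ≡⟨ regroup (λy i j) (λy j i) (λy k l) (λy l k) (g i j) (g k l) ⟩
      s * g i j + s′ * g k l
        ∎
      where
      regroup : ∀ a b c e g h → a * g + (b * g + (c * h + (e * h + 0ℚ))) ≡ (a + b) * g + (c + e) * h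
      regroup = solve-∀ ℚ-ring

    s′≡1-s : s′ ≡ 1ℚ - s
    s′≡1-s = begin
      s′                    ≡⟨ solve-for s s′ ⟩
      (s * 1ℚ + s′ * 1ℚ) - s ≡⟨ cong (_- s) (restrict (λ _ _ → 1ℚ) (λ _ _ → refl)) ⟨
      ΣΣ (λ p q → λy p q * 1ℚ) - s ≡⟨ cong (_- s) (trans (ΣΣ-cong (λ p q → *-identityʳ (λy p q))) total) ⟩
      1ℚ - s                ∎
      where
      solve-for : ∀ s s′ → s′ ≡ (s * 1ℚ + s′ * 1ℚ) - s
      solve-for = solve-∀ ℚ-ring

    s≡t : s ≡ t
    s≡t = crossing-unique s (begin
      s * v⁺ + (1ℚ - s) * v⁻ ≡⟨ cong (λ u → s * v⁺ + u * v⁻) s′≡1-s ⟨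
      s * v⁺ + s′ * v⁻       ≡⟨ restrict (λ p q → a p + a q) (λ p q → +-comm (a p) (a q)) ⟨
      ΣΣ (λ p q → λy p q * (a p + a q)) ≡⟨ lin-convex a y λy y≡ ⟨
      lin a y                ≡⟨ ay≡0 ⟩
      0ℚ                     ∎)

  x-vertex : Vertex (EdgePolytope G ∩H⁺ a) x
  x-vertex = (x∈P , ≤-reflexive (sym a-x)) , extreme
    where
    extreme : ∀ y z → (EdgePolytope G ∩H⁺ a) y → (EdgePolytope G ∩H⁺ a) z →
              (∀ m → x m ≡ ½ * (y m + z m)) → ∀ m → y m ≡ z m
    extreme y z (y∈P , 0≤ay) (z∈P , 0≤az) x≡mid m =
      trans (on-face y∈P (nonpos-+-zero wy≤0 wz≤0 w-sum) (nonneg-+-zero 0≤ay 0≤az a-sum) m)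
            (sym (on-face z∈P (nonpos-+-zero wz≤0 wy≤0 (trans (+-comm (lin w z) (lin w y)) w-sum))
                              (nonneg-+-zero 0≤az 0≤ay (trans (+-comm (lin a z) (lin a y)) a-sum)) m))
      where
      wy≤0 = lin≤-EdgePolytope G w 0ℚ w≤0 y y∈P
      wz≤0 = lin≤-EdgePolytope G w 0ℚ w≤0 z z∈P
      w-sum = lin-midpoint-zero w x≡mid w-x
      a-sum = lin-midpoint-zero a x≡mid a-x

  ¬integral : ¬ Integral (EdgePolytope G ∩H⁺ a)
  ¬integral integral = ¬integer-between-0-and-1 (subst IsIntegerℚ x-i (integral x x-vertex i)) 0<t t<1

module Pinch {d : ℕ} (i j k l : Fin d) where

  pinch : Point d
  pinch m with m Fin.≟ i | m Fin.≟ l | m Fin.≟ j | m Fin.≟ k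
  ... | yes _ | _     | _     | _     = 1ℚ
  ... | no _  | yes _ | _     | _     = 1ℚ
  ... | no _  | no _  | yes _ | _     = - 1ℚ
  ... | no _  | no _  | no _  | yes _ = - 1ℚ
  ... | no _  | no _  | no _  | no _  = - (1ℚ + 1ℚ)

  pinch-≤1 : ∀ m → pinch m ≤ 1ℚ
  pinch-≤1 m with m Fin.≟ i | m Fin.≟ l | m Fin.≟ j | m Fin.≟ k
  ... | yes _ | _     | _     | _     = ≤-refl
  ... | no _  | yes _ | _     | _     = ≤-refl
  ... | no _  | no _  | yes _ | _     = ≤-by-computation
  ... | no _  | no _  | no _  | yes _ = ≤-by-computation
  ... | no _  | no _  | no _  | no _  = ≤-by-computation

  pinch-low : ∀ {m} → ¬ (m ≡ i ⊎ m ≡ l) → pinch m ≤ - 1ℚ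
  pinch-low {m} m∉il with m Fin.≟ i | m Fin.≟ l | m Fin.≟ j | m Fin.≟ k
  ... | yes m≡i | _       | _     | _     = ⊥-elim (m∉il (inj₁ m≡i))
  ... | no _    | yes m≡l | _     | _     = ⊥-elim (m∉il (inj₂ m≡l))
  ... | no _    | no _    | yes _ | _     = ≤-refl
  ... | no _    | no _    | no _  | yes _ = ≤-refl
  ... | no _    | no _    | no _  | no _  = ≤-by-computation

  pinch-far : ∀ {m} → m ≢ i → m ≢ l → m ≢ j → m ≢ k → pinch m ≤ - (1ℚ + 1ℚ)
  pinch-far {m} m≢i m≢l m≢j m≢k with m Fin.≟ i | m Fin.≟ l | m Fin.≟ j | m Fin.≟ k
  ... | yes m≡i | _       | _       | _       = ⊥-elim (m≢i m≡i)
  ... | no _    | yes m≡l | _       | _       = ⊥-elim (m≢l m≡l)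
  ... | no _    | no _    | yes m≡j | _       = ⊥-elim (m≢j m≡j)
  ... | no _    | no _    | no _    | yes m≡k = ⊥-elim (m≢k m≡k)
  ... | no _    | no _    | no _    | no _    = ≤-refl

  pinch-i : pinch i ≡ 1ℚ
  pinch-i with i Fin.≟ i
  ... | yes _   = refl
  ... | no i≢i = ⊥-elim (i≢i refl)

  pinch-l : l ≢ i → pinch l ≡ 1ℚ
  pinch-l l≢i with l Fin.≟ i | l Fin.≟ l
  ... | yes l≡i | _        = ⊥-elim (l≢i l≡i)
  ... | no _    | yes _    = refl
  ... | no _    | no l≢l  = ⊥-elim (l≢l refl)

  pinch-j : j ≢ i → j ≢ l → pinch j ≡ - 1ℚ
  pinch-j j≢i j≢l with j Fin.≟ i | j Fin.≟ l | j Fin.≟ j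
  ... | yes j≡i | _       | _       = ⊥-elim (j≢i j≡i)
  ... | no _    | yes j≡l | _       = ⊥-elim (j≢l j≡l)
  ... | no _    | no _    | yes _   = refl
  ... | no _    | no _    | no j≢j = ⊥-elim (j≢j refl)

  pinch-k : k ≢ i → k ≢ l → pinch k ≡ - 1ℚ
  pinch-k k≢i k≢l with k Fin.≟ i | k Fin.≟ l | k Fin.≟ j | k Fin.≟ k
  ... | yes k≡i | _       | _     | _       = ⊥-elim (k≢i k≡i)
  ... | no _    | yes k≡l | _     | _       = ⊥-elim (k≢l k≡l)
  ... | no _    | no _    | yes _ | _       = refl
  ... | no _    | no _    | no _  | yes _   = refl
  ... | no _    | no _    | no _  | no k≢k = ⊥-elim (k≢k refl)

swap-orientations : ∀ {d} {i j k l p q : Fin d} → (p , q) ∈ orientations i j k l → (q , p) ∈ orientations i j k l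
swap-orientations (here refl)                         = there (here refl)
swap-orientations (there (here refl))                 = here refl
swap-orientations (there (there (here refl)))         = there (there (there (here refl)))
swap-orientations (there (there (there (here refl)))) = there (there (here refl))

-- pinch vanishes on ij and kl, and the non-adjacency hypotheses are exactly what makes it
-- negative on every other edge.
crossing⇒¬integral : ∀ {d} (G : SimpleGraph d) (a : Point d) {i j k l : Fin d} →
  Adj G i j ≡ true → Adj G k l ≡ true → 0ℚ < a i + a j → a k + a l < 0ℚ →
  i ≢ k → i ≢ l → j ≢ l → Adj G i l ≡ false → j ≡ k ⊎ (Adj G i k ≡ false × Adj G j l ≡ false) →
  ¬ Integral (EdgePolytope G ∩H⁺ a)
crossing⇒¬integral G a {i} {j} {k} {l} ij∈E kl∈E ij>0 kl<0 i≢k i≢l j≢l il∉E j≡k⊎far =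
  CrossingFace.¬integral G a pinch ij∈E kl∈E ij>0 kl<0 i≢k i≢l pinch-ij pinch-kl pinch<0
  where
  open Pinch i j k l
  pinch-ij : pinch i + pinch j ≡ 0ℚ
  pinch-ij = trans (cong₂ _+_ pinch-i (pinch-j (Adj⇒≢ G ij∈E ∘ sym) j≢l)) (+-inverseʳ 1ℚ)
  pinch-kl : pinch k + pinch l ≡ 0ℚ
  pinch-kl = trans (cong₂ _+_ (pinch-k (i≢k ∘ sym) (Adj⇒≢ G kl∈E)) (pinch-l (i≢l ∘ sym))) (+-inverseˡ 1ℚ)

  partner-bound : ∀ {p q} → p ≡ i ⊎ p ≡ l → Adj G p q ≡ true → (p , q) ∉ orientations i j k l →
                  pinch q ≤ - (1ℚ + 1ℚ)
  partner-bound {q = q} (inj₁ refl) pq∈E pq∉ = pinch-far {q}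
    (λ { refl → Adj⇒≢ G pq∈E refl })
    (λ { refl → edge≢non-edge G pq∈E il∉E })
    (λ { refl → pq∉ (here refl) })
    (λ { refl → [ (λ { refl → pq∉ (here refl) }) , (λ (ik∉E , _) → edge≢non-edge G pq∈E ik∉E) ] j≡k⊎far })
  partner-bound {q = q} (inj₂ refl) pq∈E pq∉ = pinch-far {q}
    (λ { refl → edge≢non-edge G (Adj-sym G pq∈E) il∉E })
    (λ { refl → Adj⇒≢ G pq∈E refl })
    (λ { refl → [ (λ { refl → pq∉ (there (there (there (here refl)))) })
                , (λ (_ , jl∉E) → edge≢non-edge G (Adj-sym G pq∈E) jl∉E) ] j≡k⊎far })
    (λ { refl → pq∉ (there (there (there (here refl)))) })

  pinch<0 : ∀ p q → Adj G p q ≡ true → (p , q) ∉ orientations i j k l → pinch p + pinch q < 0ℚ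
  pinch<0 p q pq∈E pq∉ with p Fin.≟ i ⊎-dec p Fin.≟ l | q Fin.≟ i ⊎-dec q Fin.≟ l
  ... | yes p-pole | _          =
    ≤-<-trans (+-mono-≤ (pinch-≤1 p) (partner-bound p-pole pq∈E pq∉)) <-by-computation
  ... | no _       | yes q-pole =
    ≤-<-trans (+-mono-≤ (partner-bound q-pole (Adj-sym G pq∈E) (pq∉ ∘ swap-orientations)) (pinch-≤1 q)) <-by-computation
  ... | no p∉      | no q∉      =
    ≤-<-trans (+-mono-≤ (pinch-low p∉) (pinch-low q∉)) <-by-computation

-- Bipartite graphs

module Bipartition {d : ℕ} (G : SimpleGraph d) (c : Fin d → Bool)
  (proper : ∀ p q → Adj G p q ≡ true → c p ≢ c q) where

  same-colour⇒non-edge : ∀ {p q} → c p ≡ c q → Adj G p q ≡ false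
  same-colour⇒non-edge {p} {q} cp≡cq with Adj G p q in pq
  ... | true  = ⊥-elim (proper p q pq cp≡cq)
  ... | false = refl

  other-colour : ∀ {p q b} → Adj G p q ≡ true → c p ≡ b → c q ≡ not b
  other-colour {p} {q} pq∈E cp≡b = trans (¬-not (proper q p (Adj-sym G pq∈E))) (cong not cp≡b)

  OrientedEdgeWith : Point d → (ℚ → Set) → Set
  OrientedEdgeWith a P = Σ (Fin d) λ i → Σ (Fin d) λ j → c i ≡ true × Adj G i j ≡ true × P (a i + a j)

  orient : ∀ {a : Point d} {P : ℚ → Set} → EdgeWith G a P → OrientedEdgeWith a P
  orient {a} {P} (p , q , pq∈E , P[pq]) with c p in cp
  ... | true  = p , q , cp , pq∈E , P[pq]
  ... | false = q , p , other-colour pq∈E cp , Adj-sym G pq∈E , subst P (+-comm (a p) (a q)) P[pq]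

  module Separated (a : Point d) (integral : Integral (EdgePolytope G ∩H⁺ a)) where

    mixed-star⇒⊥ : ∀ {v u w} → Adj G v u ≡ true → Adj G v w ≡ true →
                   0ℚ < a v + a u → a v + a w < 0ℚ → ⊥
    mixed-star⇒⊥ {v} {u} {w} vu∈E vw∈E vu>0 vw<0 =
      crossing⇒¬integral G a (Adj-sym G vu∈E) vw∈E (subst (0ℚ <_) (+-comm (a v) (a u)) vu>0) vw<0
        (Adj⇒≢ G vu∈E ∘ sym) (λ { refl → <-asym vu>0 vw<0 }) (Adj⇒≢ G vw∈E)
        (same-colour⇒non-edge (trans (other-colour vu∈E refl) (sym (other-colour vw∈E refl)))) (inj₁ refl)
        integral

    -- x and l are adjacent, or [ρ(kl), ρ(xy)] would be a crossing face; the edge xl is then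
    -- neither positive (a mixed star at l) nor negative (a mixed star at x).
    opposite-ends-cancel : ∀ {x y k l} → Adj G x y ≡ true → Adj G k l ≡ true →
                           0ℚ < a x + a y → a k + a l < 0ℚ → c x ≡ c k → a x + a l ≡ 0ℚ
    opposite-ends-cancel {x} {y} {k} {l} xy∈E kl∈E xy>0 kl<0 cx≡ck with Adj G x l in xl
    ... | false = ⊥-elim (crossing⇒¬integral G a xy∈E kl∈E xy>0 kl<0 x≢k x≢l y≢l xl
                           (inj₂ (same-colour⇒non-edge cx≡ck , same-colour⇒non-edge cy≡cl)) integral)
      where
      x≢k : x ≢ k
      x≢k refl = mixed-star⇒⊥ xy∈E kl∈E xy>0 kl<0
      x≢l : x ≢ l
      x≢l refl = proper k x kl∈E (sym cx≡ck)
      y≢l : y ≢ l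
      y≢l refl = mixed-star⇒⊥ (Adj-sym G xy∈E) (Adj-sym G kl∈E)
                   (subst (0ℚ <_) (+-comm (a x) (a y)) xy>0) (subst (_< 0ℚ) (+-comm (a k) (a y)) kl<0)
      cy≡cl : c y ≡ c l
      cy≡cl = trans (other-colour xy∈E refl) (trans (cong not cx≡ck) (sym (other-colour kl∈E refl)))
    ... | true with <-cmp (a x + a l) 0ℚ
    ...   | tri< xl<0 _ _ = ⊥-elim (mixed-star⇒⊥ xy∈E xl xy>0 xl<0)
    ...   | tri≈ _ xl≡0 _ = xl≡0
    ...   | tri> _ _ xl>0 = ⊥-elim (mixed-star⇒⊥ (Adj-sym G xl) (Adj-sym G kl∈E)
                                      (subst (0ℚ <_) (+-comm (a x) (a l)) xl>0)
                                      (subst (_< 0ℚ) (+-comm (a k) (a l)) kl<0))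

  module Rigid (a : Point d) (integral : Integral (EdgePolytope G ∩H⁺ a)) (connected : Connected G)
    {i j k l : Fin d} (ij∈E : Adj G i j ≡ true) (kl∈E : Adj G k l ≡ true)
    (ij>0 : 0ℚ < a i + a j) (kl<0 : a k + a l < 0ℚ) (ci : c i ≡ true) (ck : c k ≡ true) where

    open Separated a integral

    σ : Fin d → ℚ
    σ v = if c v then 1ℚ else - 1ℚ

    b : Fin d → ℚ
    b v = σ v * a v

    α β : ℚ
    α = a i
    β = - a j

    b-true : ∀ {v} → c v ≡ true → b v ≡ a v
    b-true {v} cv = trans (cong (λ z → (if z then 1ℚ else - 1ℚ) * a v) cv) (*-identityˡ (a v))

    b-false : ∀ {v} → c v ≡ false → b v ≡ - a v
    b-false {v} cv = trans (cong (λ z → (if z then 1ℚ else - 1ℚ) * a v) cv) (-1*x≈-x (a v))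

    σ-edge : ∀ {p q} → Adj G p q ≡ true → σ p + σ q ≡ 0ℚ
    σ-edge {p} {q} pq∈E with c p in cp
    ... | true  rewrite other-colour pq∈E cp = +-inverseʳ 1ℚ
    ... | false rewrite other-colour pq∈E cp = +-inverseˡ 1ℚ

    σ-unit : ∀ v → σ v ≡ 1ℚ ⊎ σ v ≡ - 1ℚ
    σ-unit v with c v
    ... | true  = inj₁ refl
    ... | false = inj₂ refl

    a≡σb : ∀ v → a v ≡ σ v * b v
    a≡σb v with σ-unit v
    ... | inj₁ σ≡1  = trans (square-one (a v)) (cong (λ s → s * (s * a v)) (sym σ≡1))
      where
      square-one : ∀ u → u ≡ 1ℚ * (1ℚ * u)
      square-one = solve-∀ ℚ-ring
    ... | inj₂ σ≡-1 = trans (square-one (a v)) (cong (λ s → s * (s * a v)) (sym σ≡-1))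
      where
      square-one : ∀ u → u ≡ - 1ℚ * (- 1ℚ * u)
      square-one = solve-∀ ℚ-ring

    il : a i + a l ≡ 0ℚ
    il = opposite-ends-cancel ij∈E kl∈E ij>0 kl<0 (trans ci (sym ck))

    cj : c j ≡ false
    cj = other-colour ij∈E ci

    cl : c l ≡ false
    cl = other-colour kl∈E ck

    jk : a j + a k ≡ 0ℚ
    jk = opposite-ends-cancel (Adj-sym G ij∈E) (Adj-sym G kl∈E) (subst (0ℚ <_) (+-comm (a i) (a j)) ij>0)
                              (subst (_< 0ℚ) (+-comm (a k) (a l)) kl<0) (trans cj (sym cl))

    TwoValued : Fin d → Set
    TwoValued v = b v ≡ α ⊎ b v ≡ β

    by-colour : {X : Set} (v : Fin d) → (c v ≡ true → X) → (c v ≡ false → X) → X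
    by-colour v if-true if-false with c v
    ... | true  = if-true refl
    ... | false = if-false refl

    positive-endpoint : ∀ {p q} → Adj G p q ≡ true → 0ℚ < a p + a q → TwoValued p
    positive-endpoint {p} {q} pq∈E pq>0 = by-colour p
      (λ cp → inj₁ (trans (b-true cp)
                     (+≡0-cancelʳ (opposite-ends-cancel pq∈E kl∈E pq>0 kl<0 (trans cp (sym ck))) il)))
      (λ cp → inj₂ (trans (b-false cp) (cong -_
                     (+≡0-cancelʳ (opposite-ends-cancel pq∈E (Adj-sym G kl∈E) pq>0
                                    (subst (_< 0ℚ) (+-comm (a k) (a l)) kl<0) (trans cp (sym cl)))
                                  jk))))

    negative-endpoint : ∀ {p q} → Adj G p q ≡ true → a p + a q < 0ℚ → TwoValued p
    negative-endpoint {p} {q} pq∈E pq<0 = by-colour p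
      (λ cp → inj₂ (trans (b-true cp)
                     (+≡0⇒≡-ʳ (opposite-ends-cancel (Adj-sym G ij∈E) (Adj-sym G pq∈E)
                                (subst (0ℚ <_) (+-comm (a i) (a j)) ij>0)
                                (subst (_< 0ℚ) (+-comm (a p) (a q)) pq<0)
                                (trans cj (sym (other-colour pq∈E cp)))))))
      (λ cp → inj₁ (trans (b-false cp)
                     (sym (+≡0⇒≡-ˡ (opposite-ends-cancel ij∈E (Adj-sym G pq∈E) ij>0
                                     (subst (_< 0ℚ) (+-comm (a p) (a q)) pq<0)
                                     (trans ci (sym (other-colour pq∈E cp))))))))

    zero-edge : ∀ {p q} → Adj G p q ≡ true → a p + a q ≡ 0ℚ → b p ≡ b q
    zero-edge {p} {q} pq∈E pq≡0 = begin
      σ p * a p         ≡⟨ cong₂ _*_ (+≡0⇒≡-ˡ {σ p} {σ q} (σ-edge pq∈E)) (+≡0⇒≡-ˡ {a p} {a q} pq≡0) ⟩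
      - σ q * - a q     ≡⟨ neg*neg (σ q) (a q) ⟩
      σ q * a q         ∎
      where
      open ≡-Reasoning
      neg*neg : ∀ x y → - x * - y ≡ x * y
      neg*neg = solve-∀ ℚ-ring

    edge-step : ∀ {v u} → Adj G v u ≡ true → TwoValued u → TwoValued v
    edge-step {v} {u} vu∈E u-two with <-cmp (a v + a u) 0ℚ
    ... | tri< vu<0 _ _ = negative-endpoint vu∈E vu<0
    ... | tri≈ _ vu≡0 _ = Sum.map (trans (zero-edge vu∈E vu≡0)) (trans (zero-edge vu∈E vu≡0)) u-two
    ... | tri> _ _ vu>0 = positive-endpoint vu∈E vu>0

    two-valued : ∀ v → TwoValued v
    two-valued v = along (connected v i)
      where
      along : ∀ {v} → Walk G v i → TwoValued v
      along here              = inj₁ (b-true ci)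
      along (step vu∈E walk) = edge-step vu∈E (along walk)

    μ ν : ℚ
    μ = ½ * (α - β)
    ν = ½ * (α + β)

    μ>0 : 0ℚ < μ
    μ>0 = positive⁻¹ μ {{pos*pos⇒pos ½ (α - β) {{positive (subst (0ℚ <_) (sym (sub-neg (a i) (a j))) ij>0)}}}}
      where
      sub-neg : ∀ x y → x - (- y) ≡ x + y
      sub-neg = solve-∀ ℚ-ring

    sign : Fin d → ℚ
    sign v with b v ≟ α
    ... | yes _ = 1ℚ
    ... | no _  = - 1ℚ

    sign-unit : ∀ v → sign v ≡ 1ℚ ⊎ sign v ≡ - 1ℚ
    sign-unit v with b v ≟ α
    ... | yes _ = inj₁ refl
    ... | no _  = inj₂ refl

    b-affine : ∀ v → b v ≡ ν + μ * sign v
    b-affine v with b v ≟ α | two-valued v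
    ... | yes bv≡α | _         = trans bv≡α (top α β)
      where
      top : ∀ α β → α ≡ ½ * (α + β) + ½ * (α - β) * 1ℚ
      top = solve-∀ ℚ-ring
    ... | no bv≢α  | inj₁ bv≡α = ⊥-elim (bv≢α bv≡α)
    ... | no _     | inj₂ bv≡β = trans bv≡β (bottom α β)
      where
      bottom : ∀ α β → β ≡ ½ * (α + β) + ½ * (α - β) * - 1ℚ
      bottom = solve-∀ ℚ-ring

    a′ : Point d
    a′ v = σ v * sign v

    a′-typeI : TypeI a′
    a′-typeI v with σ-unit v | sign-unit v
    ... | inj₁ σ≡1  | inj₁ s≡1  = inj₁ (cong₂ _*_ σ≡1 s≡1)
    ... | inj₁ σ≡1  | inj₂ s≡-1 = inj₂ (cong₂ _*_ σ≡1 s≡-1)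
    ... | inj₂ σ≡-1 | inj₁ s≡1  = inj₂ (cong₂ _*_ σ≡-1 s≡1)
    ... | inj₂ σ≡-1 | inj₂ s≡-1 = inj₁ (cong₂ _*_ σ≡-1 s≡-1)

    a-edge : ∀ p q → Adj G p q ≡ true → a p + a q ≡ μ * (a′ p + a′ q)
    a-edge p q pq∈E = begin
      a p + a q                                           ≡⟨ cong₂ _+_ (a≡σb p) (a≡σb q) ⟩
      σ p * b p + σ q * b q                               ≡⟨ cong₂ (λ u v → σ p * u + σ q * v) (b-affine p) (b-affine q) ⟩
      σ p * (ν + μ * sign p) + σ q * (ν + μ * sign q)     ≡⟨ expand (σ p) (σ q) (sign p) (sign q) ν μ ⟩
      (σ p + σ q) * ν + μ * (a′ p + a′ q)                 ≡⟨ cong (λ z → z * ν + μ * (a′ p + a′ q)) (σ-edge pq∈E) ⟩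
      0ℚ * ν + μ * (a′ p + a′ q)                          ≡⟨ drop ν (μ * (a′ p + a′ q)) ⟩
      μ * (a′ p + a′ q)                                   ∎
      where
      open ≡-Reasoning
      expand : ∀ σp σq sp sq ν μ →
               σp * (ν + μ * sp) + σq * (ν + μ * sq) ≡ (σp + σq) * ν + μ * (σp * sp + σq * sq)
      expand = solve-∀ ℚ-ring
      drop : ∀ ν z → 0ℚ * ν + z ≡ z
      drop = solve-∀ ℚ-ring

    lin-a≡μ*lin-a′ : ∀ x → EdgePolytope G x → lin a x ≡ μ * lin a′ x
    lin-a≡μ*lin-a′ = lin-proportional G a a′ μ a-edge

proposition2p4 : (d : ℕ) (G : SimpleGraph d) → Connected G → Bipartite G →
    (a : Point d) → TypeII a → Separating (EdgePolytope G) a →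
    Σ (Point d) λ a' → TypeI a' × Separating (EdgePolytope G) a' × SameDecomposition (EdgePolytope G) a a'
proposition2p4 d G connected (c , proper) a _ sep@((x₀ , x₀∈ri , ax₀≡0) , nontrivial , integral , _) =
  replace (orient {a} {0ℚ <_} (positive-edge G a x₀∈ri ax₀≡0 nontrivial))
          (orient {a} {_< 0ℚ} (negative-edge G a x₀∈ri ax₀≡0 nontrivial))
  where
  open Bipartition G c proper
  replace : OrientedEdgeWith a (0ℚ <_) → OrientedEdgeWith a (_< 0ℚ) →
            Σ (Point d) λ a' → TypeI a' × Separating (EdgePolytope G) a' × SameDecomposition (EdgePolytope G) a a'
  replace (i , j , ci , ij∈E , ij>0) (k , l , ck , kl∈E , kl<0) =
    a′ , a′-typeI , rescale-separating μ>0 {a = a} {a′ = a′} lin-a≡μ*lin-a′ sep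
    where open Rigid a integral connected ij∈E kl∈E ij>0 kl<0 ci ck
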